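{- Let $\mathcal{R}=(r_1,\dots,r_\ell)$ with $\ell\ge0$ be a decreasing sequence of positive integers. For every integer $m\ge0$, $$\{m+1\}_{\mathcal{R}}=\sum_{T\in\Delta_{m,\mathcal{R}}}\mathrm{wt}(T).$$
   Context: Let $s_1,s_2,\dots$ be commuting indeterminates and $\mathbb{Z}[S]=\mathbb{Z}[s_1,s_2,\dots]$. The Lucas polynomials $\{m\}\in\mathbb{Z}[s_1,s_2]$ are defined by $\{0\}=0$, $\{1\}=1$, $\{m\}=s_1\{m-1\}+s_2\{m-2\}$ for $m\ge2$. For a positive integer $r$, $\phi_r:\mathbb{Z}[s_1,s_2]\to\mathbb{Z}[S]$ is the ring homomorphism with $\phi_r(s_1)=s_r$, $\phi_r(s_2)=s_{2r}$. Here $a\bmod r\in\{0,\dots,r-1\}$ is the remainder (also for negative $a$), and $\varepsilon_r(m)=((m-1)\bmod r)+1\in\{1,\dots,r\}$. For $\mathcal{R}=(r_1,\dots,r_\ell)$ write $\mathcal{R}'=(r_2,\dots,r_\ell)$ and $\varnothing$ for the empty sequence. The $\mathcal{R}$-Lucas polynomials are defined for $m\ge1$ recursively by $\{m\}_\varnothing=s_1^{m-1}$ and, for $\ell\ge1$, $\{m\}_{\mathcal{R}}=\{\varepsilon_{r_1}(m)\}_{\mathcal{R}'}\cdot\phi_{r_1}\bigl(\{\lceil m/r_1\rceil\}\bigr)$. For $i\ge1$ let $\tau_i$ be a tile of length $i$; a tiling word of $k\ge0$ is a word $\tau_{i_1}\cdots\tau_{i_j}$ with $i_1+\cdots+i_j=k$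 (the empty word for $k=0$), with weight $\mathrm{wt}=s_{i_1}\cdots s_{i_j}$. The set $\Delta_{m,\mathcal{R}}$ of tiling words of $m\ge0$ is defined recursively: $\Delta_{m,\varnothing}=\{\tau_1^m\}$, and for $\ell\ge1$, $\Delta_{m,\mathcal{R}}$ consists of all words $T'W$ where $T'\in\Delta_{m\bmod r_1,\mathcal{R}'}$ and $W$ is any word in the tiles $\tau_{r_1},\tau_{2r_1}$ of total length $m-(m\bmod r_1)$. -}

module Defs where

open import Level using (Level)
open import Algebra.Bundles using (CommutativeRing)
open import Data.Nat using (ℕ; zero; suc; _∸_)
import Data.Nat as N
open import Data.Nat.DivMod using (_%_; _/_)
open import Data.List using (List; []; _∷_; _++_; map; concatMap; replicate; foldr)
open import Relation.Nullary using (yes; no)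

-- Sequences R = (r₁,…,r_ℓ) are lists of naturals.  The hypotheses of the
-- lemma force all entries to be positive; at r = 0 the definitions below
-- return junk values that are never used.

_mod_ : ℕ → ℕ → ℕ
a mod zero    = a
a mod (suc k) = a % suc k

ε : ℕ → ℕ → ℕ
ε r m = suc ((m ∸ 1) mod r)

ceilDiv : ℕ → ℕ → ℕ
ceilDiv m zero    = m
ceilDiv m (suc k) = (m N.+ k) / suc k

-- A tiling word τ_{i₁}⋯τ_{i_j} is represented by the list [i₁,…,i_j].
Word : Set
Word = List ℕ

-- All words in the tiles τ_r, τ_{2r} of total length n (fuel-driven
-- enumeration; fuel n suffices since r ≥ 1).
tiles₁₂-aux : ℕ → ℕ → ℕ → List Word
tiles₁₂-aux r _ zero = [] ∷ []
tiles₁₂-aux r zero (suc _) = []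
tiles₁₂-aux zero (suc f) (suc n) = []
tiles₁₂-aux (suc k) (suc f) (suc n) = first ++ second
  where
  r = suc k
  first : List Word
  first with r N.≤? suc n
  ... | yes _ = map (r ∷_) (tiles₁₂-aux r f (suc n ∸ r))
  ... | no _  = []
  second : List Word
  second with (2 N.* r) N.≤? suc n
  ... | yes _ = map ((2 N.* r) ∷_) (tiles₁₂-aux r f (suc n ∸ (2 N.* r)))
  ... | no _  = []

tilesR : ℕ → ℕ → List Word
tilesR r n = tiles₁₂-aux r n n

Δ : ℕ → List ℕ → List Word
Δ m [] = replicate m 1 ∷ []
Δ m (r ∷ R) =
  concatMap (λ T' → map (T' ++_) (tilesR r (m ∸ (m mod r)))) (Δ (m mod r) R)

-- Polynomial identities in ℤ[S] = ℤ[s₁,s₂,…] are expressed via evaluation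
-- at an arbitrary point s : ℕ → A of an arbitrary commutative ring A
-- (ℤ[S] is the free commutative ring on the sᵢ; s 0 is unused).
module Poly {c ℓ : Level} (A : CommutativeRing c ℓ) (s : ℕ → CommutativeRing.Carrier A) where
  open CommutativeRing A

  -- Lucas polynomials {m} evaluated at s₁ := a, s₂ := b
  lucas : Carrier → Carrier → ℕ → Carrier
  lucas a b zero = 0#
  lucas a b (suc zero) = 1#
  lucas a b (suc (suc m)) = a * lucas a b (suc m) + b * lucas a b m

  φlucas : ℕ → ℕ → Carrier
  φlucas r m = lucas (s r) (s (2 N.* r)) m

  pow : Carrier → ℕ → Carrier
  pow x zero = 1#
  pow x (suc n) = x * pow x n

  RLucas : List ℕ → ℕ → Carrier
  RLucas [] m = pow (s 1) (m ∸ 1)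
  RLucas (r ∷ R) m = RLucas R (ε r m) * φlucas r (ceilDiv m r)

  wt : Word → Carrier
  wt = foldr (λ i acc → s i * acc) 1#

  sumC : List Carrier → Carrier
  sumC = foldr _+_ 0#

-- Δ_{m,R} is by definition the set of concatenations T'W with T' ∈ Δ_{m mod r, R'} and W
-- a tiling of m − m mod r = ⌊m/r⌋·r by τ_r and τ_{2r}, so its weight sum is the product
-- of the two weight sums.  Splitting a tiling by its first tile shows that the tilings of
-- q·r by τ_r, τ_{2r} have weight sum φ_r{q+1}, following the Lucas recurrence.  Since
-- ε_r(m+1) = m mod r + 1 and ⌈(m+1)/r⌉ = ⌊m/r⌋ + 1, induction on the length of R closes.
module Submission where

open import Defs
open import Level using (Level)
open import Algebra.Bundles using (CommutativeRing)
open import Data.Nat as N using (ℕ; zero; suc; _∸_; _≤_; _<_; _>_; _≤?_; z≤n; s≤s)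
open import Data.Nat.Properties
  using ( ≤-refl; ≤-trans; m≤m+n; m≤n+m; +-monoʳ-≤; +-monoʳ-<; <-≤-trans; <-irrefl
        ; +-suc; m+n∸m≡n; m+n∸n≡m; [m+n]∸[m+o]≡n∸o)
open import Data.Nat.DivMod using (_%_; _/_; m≡m%n+[m/n]*n; m/n≡1+[m∸n]/n)
open import Data.List using (List; []; _∷_; _++_; map; concatMap; replicate)
open import Data.List.Properties using (map-++)
open import Data.List.Relation.Unary.All using (All; _∷_)
open import Data.List.Relation.Unary.Linked using (Linked)
open import Relation.Binary.PropositionalEquality using (_≡_)
import Relation.Binary.PropositionalEquality as ≡
open import Relation.Nullary using (yes; no; contradiction)
import Relation.Binary.Reasoning.Setoid as SetoidReasoning

m∸m%n≡[m/n]*n : ∀ m k → m ∸ m % suc k ≡ (m / suc k) N.* suc k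
m∸m%n≡[m/n]*n m k = ≡.trans (≡.cong (_∸ m % suc k) (m≡m%n+[m/n]*n m (suc k))) (m+n∸m≡n (m % suc k) _)

ceilDiv-suc : ∀ m k → ceilDiv (suc m) (suc k) ≡ suc (m / suc k)
ceilDiv-suc m k = ≡.trans (≡.cong (_/ suc k) (≡.sym (+-suc m k)))
    (≡.trans (m/n≡1+[m∸n]/n (m≤n+m (suc k) m)) (≡.cong (λ n → suc (n / suc k)) (m+n∸n≡m m (suc k))))

module _ {c ℓ : Level} (A : CommutativeRing c ℓ) (s : ℕ → CommutativeRing.Carrier A) where
  open CommutativeRing A hiding (zero)
  open Poly A s
  open SetoidReasoning setoid

  weightSum : List Word → Carrier
  weightSum Ws = sumC (map wt Ws)

  sumC-++ : ∀ xs ys → sumC (xs ++ ys) ≈ sumC xs + sumC ys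
  sumC-++ [] ys = sym (+-identityˡ _)
  sumC-++ (x ∷ xs) ys = trans (+-congˡ (sumC-++ xs ys)) (sym (+-assoc _ _ _))

  weightSum-++ : ∀ Ts Ws → weightSum (Ts ++ Ws) ≈ weightSum Ts + weightSum Ws
  weightSum-++ Ts Ws = begin
    sumC (map wt (Ts ++ Ws))        ≡⟨ ≡.cong sumC (map-++ wt Ts Ws) ⟩
    sumC (map wt Ts ++ map wt Ws)   ≈⟨ sumC-++ (map wt Ts) (map wt Ws) ⟩
    weightSum Ts + weightSum Ws     ∎

  wt-++ : ∀ T W → wt (T ++ W) ≈ wt T * wt W
  wt-++ [] W = sym (*-identityˡ _)
  wt-++ (i ∷ T) W = trans (*-congˡ (wt-++ T W)) (sym (*-assoc _ _ _))

  wt-replicate-1 : ∀ m → wt (replicate m 1) ≈ pow (s 1) m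
  wt-replicate-1 zero = refl
  wt-replicate-1 (suc m) = *-congˡ (wt-replicate-1 m)

  weightSum-prefix : ∀ T Ws → weightSum (map (T ++_) Ws) ≈ wt T * weightSum Ws
  weightSum-prefix T [] = sym (zeroʳ _)
  weightSum-prefix T (W ∷ Ws) = begin
    wt (T ++ W) + weightSum (map (T ++_) Ws)  ≈⟨ +-cong (wt-++ T W) (weightSum-prefix T Ws) ⟩
    wt T * wt W + wt T * weightSum Ws          ≈⟨ sym (distribˡ _ _ _) ⟩
    wt T * (wt W + weightSum Ws)               ∎

  weightSum-cons : ∀ i Ws → weightSum (map (i ∷_) Ws) ≈ s i * weightSum Ws
  weightSum-cons i Ws = trans (weightSum-prefix (i ∷ []) Ws) (*-congʳ (*-identityʳ (s i)))

  weightSum-concatMap-prefix : ∀ Ts Ws →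
    weightSum (concatMap (λ T → map (T ++_) Ws) Ts) ≈ weightSum Ts * weightSum Ws
  weightSum-concatMap-prefix [] Ws = sym (zeroˡ _)
  weightSum-concatMap-prefix (T ∷ Ts) Ws = begin
    weightSum (map (T ++_) Ws ++ concatMap (λ T → map (T ++_) Ws) Ts)
      ≈⟨ weightSum-++ (map (T ++_) Ws) _ ⟩
    weightSum (map (T ++_) Ws) + weightSum (concatMap (λ T → map (T ++_) Ws) Ts)
      ≈⟨ +-cong (weightSum-prefix T Ws) (weightSum-concatMap-prefix Ts Ws) ⟩
    wt T * weightSum Ws + weightSum Ts * weightSum Ws
      ≈⟨ sym (distribʳ _ _ _) ⟩
    (wt T + weightSum Ts) * weightSum Ws ∎

  weightSum-tiles₁₂-length-r : ∀ k f → weightSum (tiles₁₂-aux (suc k) (suc f) (1 N.* suc k)) ≈ s (suc k)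
  weightSum-tiles₁₂-length-r k f with suc k ≤? 1 N.* suc k | 2 N.* suc k ≤? 1 N.* suc k
  ... | no r≰r | _ = contradiction (m≤m+n (suc k) 0) r≰r
  ... | yes _ | yes 2r≤r = contradiction (<-≤-trans (+-monoʳ-< (suc k) (s≤s z≤n)) 2r≤r) (<-irrefl ≡.refl)
  ... | yes _ | no _ rewrite m+n∸m≡n k 0 = begin
    weightSum (map (suc k ∷_) (tiles₁₂-aux (suc k) f 0) ++ [])
      ≈⟨ trans (weightSum-++ (map (suc k ∷_) (tiles₁₂-aux (suc k) f 0)) []) (+-identityʳ _) ⟩
    weightSum (map (suc k ∷_) (tiles₁₂-aux (suc k) f 0))
      ≈⟨ weightSum-cons (suc k) (tiles₁₂-aux (suc k) f 0) ⟩
    s (suc k) * (1# + 0#)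
      ≈⟨ trans (*-congˡ (+-identityʳ 1#)) (*-identityʳ _) ⟩
    s (suc k) ∎

  weightSum-tiles₁₂-first-tile : ∀ k f m →
    weightSum (tiles₁₂-aux (suc k) (suc f) (suc k N.+ (suc k N.+ m)))
      ≈ s (suc k) * weightSum (tiles₁₂-aux (suc k) f (suc k N.+ m))
        + s (2 N.* suc k) * weightSum (tiles₁₂-aux (suc k) f m)
  weightSum-tiles₁₂-first-tile k f m
    with suc k ≤? suc k N.+ (suc k N.+ m) | 2 N.* suc k ≤? suc k N.+ (suc k N.+ m)
  ... | no r≰n | _ = contradiction (m≤m+n (suc k) _) r≰n
  ... | yes _ | no 2r≰n = contradiction (+-monoʳ-≤ (suc k) (+-monoʳ-≤ (suc k) z≤n)) 2r≰n
  ... | yes _ | yes _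
    rewrite m+n∸m≡n k (suc k N.+ m)
          | [m+n]∸[m+o]≡n∸o k (suc k N.+ m) (suc k N.+ 0)
          | [m+n]∸[m+o]≡n∸o (suc k) m 0
    = trans (weightSum-++ (map (suc k ∷_) (tiles₁₂-aux (suc k) f (suc k N.+ m)))
                          (map (2 N.* suc k ∷_) (tiles₁₂-aux (suc k) f m)))
            (+-cong (weightSum-cons (suc k) (tiles₁₂-aux (suc k) f (suc k N.+ m)))
                    (weightSum-cons (2 N.* suc k) (tiles₁₂-aux (suc k) f m)))

  weightSum-tiles₁₂ : ∀ k q f → q N.* suc k ≤ f →
    weightSum (tiles₁₂-aux (suc k) f (q N.* suc k)) ≈ φlucas (suc k) (suc q)
  weightSum-tiles₁₂ k zero f _ = +-identityʳ 1#
  weightSum-tiles₁₂ k (suc zero) (suc f) _ = begin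
    weightSum (tiles₁₂-aux (suc k) (suc f) (1 N.* suc k))  ≈⟨ weightSum-tiles₁₂-length-r k f ⟩
    s (suc k)                                             ≈⟨ sym (*-identityʳ _) ⟩
    s (suc k) * 1#                                        ≈⟨ sym (+-identityʳ _) ⟩
    s (suc k) * 1# + 0#                                   ≈⟨ +-congˡ (sym (zeroʳ _)) ⟩
    φlucas (suc k) 2                                      ∎
  weightSum-tiles₁₂ k (suc (suc q)) (suc f) (s≤s n≤f) = begin
    weightSum (tiles₁₂-aux (suc k) (suc f) (suc k N.+ (suc k N.+ q N.* suc k)))
      ≈⟨ weightSum-tiles₁₂-first-tile k f (q N.* suc k) ⟩
    s (suc k) * weightSum (tiles₁₂-aux (suc k) f (suc q N.* suc k))
      + s (2 N.* suc k) * weightSum (tiles₁₂-aux (suc k) f (q N.* suc k))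
      ≈⟨ +-cong (*-congˡ (weightSum-tiles₁₂ k (suc q) f [q+1]r≤f))
                (*-congˡ (weightSum-tiles₁₂ k q f (≤-trans (m≤n+m _ (suc k)) [q+1]r≤f))) ⟩
    φlucas (suc k) (suc (suc (suc q))) ∎
    where
    [q+1]r≤f : suc q N.* suc k ≤ f
    [q+1]r≤f = ≤-trans (m≤n+m _ k) n≤f

  weightSum-tilesR : ∀ k q → weightSum (tilesR (suc k) (q N.* suc k)) ≈ φlucas (suc k) (suc q)
  weightSum-tilesR k q = weightSum-tiles₁₂ k q (q N.* suc k) ≤-refl

  RLucas-weightSum : ∀ R → All (0 <_) R → ∀ m → RLucas R (suc m) ≈ weightSum (Δ m R)
  RLucas-weightSum [] _ m = sym (trans (+-identityʳ _) (wt-replicate-1 m))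
  RLucas-weightSum (suc k ∷ R) (_ ∷ R>0) m = begin
    RLucas R (suc (m % r)) * φlucas r (ceilDiv (suc m) r)
      ≡⟨ ≡.cong (λ n → RLucas R (suc (m % r)) * φlucas r n) (ceilDiv-suc m k) ⟩
    RLucas R (suc (m % r)) * φlucas r (suc (m / r))
      ≈⟨ *-cong (RLucas-weightSum R R>0 (m % r)) (sym (weightSum-tilesR k (m / r))) ⟩
    weightSum (Δ (m % r) R) * weightSum (tilesR r ((m / r) N.* r))
      ≡⟨ ≡.cong (λ n → weightSum (Δ (m % r) R) * weightSum (tilesR r n)) (≡.sym (m∸m%n≡[m/n]*n m k)) ⟩
    weightSum (Δ (m % r) R) * weightSum (tilesR r (m ∸ m % r))
      ≈⟨ sym (weightSum-concatMap-prefix (Δ (m % r) R) (tilesR r (m ∸ m % r))) ⟩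
    weightSum (Δ m (r ∷ R)) ∎
    where
    r = suc k

lemma7p1 : {c ℓ : Level} (A : CommutativeRing c ℓ) (s : ℕ → CommutativeRing.Carrier A)
    (R : List ℕ) → All (λ r → 0 < r) R → Linked _>_ R → (m : ℕ) →
    CommutativeRing._≈_ A (Poly.RLucas A s R (suc m)) (Poly.sumC A s (map (Poly.wt A s) (Δ m R)))
lemma7p1 A s R R>0 _ m = RLucas-weightSum A s R R>0 m
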